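{- Let $G=(V,E)$ be a finite undirected graph and $T$ a rooted spanning tree of $G$ with root $r_T$. Let $S=\{x_1,\dots,x_k\}\subset V\setminus\{r_T\}$ with $|S|=k\ge3$. Suppose: (1) there exist $x,y\in S$ with $x^{\downarrow T}\cap y^{\downarrow T}\neq\emptyset$; (2) there exists $x'\in S$ such that $y'\in x'^{\downarrow T}$ for all $y'\in S$; (3) for every $x''\in S$ there exists $y''\in S$ with $y''\notin x''^{\uparrow T}$. Then $\gamma(x_1^{\downarrow T},x_2^{\downarrow T},\dots,x_k^{\downarrow T})=0$.
   Context: $v^{\downarrow T}$ is the set of descendants of $v$ in $T$, including $v$. $v^{\uparrow T}$ is the set of vertices on the tree path from $r_T$ to $v$ (including both). For $B\subseteq V$, $\delta(B)$ is the set of edges of $G$ with exactly one endpoint in $B$. For vertex sets $A_1,\dots,A_i\subseteq V$, $\gamma(A_1,\dots,A_i)=|\delta(A_1)\cap\cdots\cap\delta(A_i)|$. -}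

module Defs where

open import Data.Nat using (ℕ; zero; suc; _<ᵇ_)
open import Data.Bool using (Bool; true; false; _∧_; _xor_; if_then_else_)
open import Data.Fin using (Fin; toℕ; _≟_)
open import Data.List using (List; map; allFin; upTo)
open import Data.Bool.ListAction using (any; all)
open import Data.Nat.ListAction using (sum)
open import Data.Product using (∃)
open import Relation.Binary.PropositionalEquality using (_≡_; _≢_)
open import Relation.Nullary.Decidable using (⌊_⌋)

record Graph (n : ℕ) : Set where
  field
    adj    : Fin n → Fin n → Bool
    sym    : ∀ u v → adj u v ≡ adj v u
    irrefl : ∀ v → adj v v ≡ false
open Graph public

iter : {A : Set} → (A → A) → ℕ → A → A
iter f zero    a = a
iter f (suc k) a = f (iter f k a)

-- A rooted spanning tree T of G, given by its root r_T and parent map: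
-- the tree edges are {v, parent v} for v ≠ r_T (all edges of G), and
-- every vertex reaches the root by following parents (so no cycles).
record RootedSpanningTree {n : ℕ} (G : Graph n) : Set where
  field
    root         : Fin n
    parent       : Fin n → Fin n
    parent-root  : parent root ≡ root
    parent-edge  : ∀ v → v ≢ root → adj G v (parent v) ≡ true
    reaches-root : ∀ v → ∃ λ k → iter parent k v ≡ root
open RootedSpanningTree public

-- u ∈ v^{↑T} : u lies on the tree path from r_T to v, i.e. u is obtained
-- from v by following parents some number k of times.  Since a tree path
-- on n vertices has fewer than n edges (and parent r_T = r_T), it suffices
-- to test k = 0,…,n; this makes membership decidable.
_∈↑_ : {n : ℕ} {G : Graph n} {T : RootedSpanningTree G} → Fin n → Fin n → Bool
_∈↑_ {n} {G} {T} u v = any (λ k → ⌊ iter (parent T) k v ≟ u ⌋) (upTo (suc n))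

up : {n : ℕ} {G : Graph n} (T : RootedSpanningTree G) → Fin n → (Fin n → Bool)
up {n} {G} T v u = _∈↑_ {n} {G} {T} u v

down : {n : ℕ} {G : Graph n} (T : RootedSpanningTree G) → Fin n → (Fin n → Bool)
down {n} {G} T v u = _∈↑_ {n} {G} {T} v u

-- e = {u,v} ∈ δ(B) : exactly one endpoint in B.
-- γ(A_1,…,A_i) = |δ(A_1) ∩ ⋯ ∩ δ(A_i)| : the number of edges {u,v}
-- (counted once, as u < v) lying in every δ(A_j).
γ : {n : ℕ} → Graph n → List (Fin n → Bool) → ℕ
γ {n} G As =
  sum (map (λ u → sum (map (λ v →
    if (toℕ u <ᵇ toℕ v) ∧ adj G u v ∧ all (λ A → A u xor A v) As
    then 1 else 0) (allFin n))) (allFin n))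

module Submission where

-- If an edge {u, v} crossed every δ(x_i↓), then, x' being a common ancestor of all x_i, the
-- endpoint outside x'↓ (say v) lies outside every x_i↓, so the other endpoint u lies in every
-- x_i↓: all x_i are ancestors of u.  Ancestors of u form a chain, and its lowest x_i is a
-- descendant of every x_j, contradicting (3).

open import Defs hiding (sym)
open import Data.Bool using (Bool; true; false; _xor_; _∧_; if_then_else_)
open import Data.Bool.ListAction using (all)
open import Data.Bool.Properties using (xor-comm; xor-identityʳ; ∧-zeroʳ; ¬-not; T-≡)
open import Data.Empty using (⊥)
open import Data.Fin using (Fin; toℕ)
open import Data.Fin.Properties using (pigeonhole; toℕ<n)
open import Data.List using (List; []; _∷_; map; allFin; upTo)
import Data.List.Relation.Unary.All as All
import Data.List.Relation.Unary.All.Properties as All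
import Data.List.Relation.Unary.Any.Properties as Any
open import Data.List.Membership.Propositional using (_∈_; find; lose)
open import Data.List.Membership.Propositional.Properties using (∈-upTo⁺; ∈-allFin; ∈-map⁺)
open import Data.Nat using (ℕ; suc; s≤s; s≤s⁻¹; _+_; _∸_; _≤_; _<_; _≥_; _≤?_; _<ᵇ_)
open import Data.Nat.Induction using (<-rec)
open import Data.Nat.ListAction using (sum)
open import Data.Nat.Properties using (m∸n+n≡m; +-monoʳ-<; n<1+n; ≰⇒>; <⇒≤; ≤-<-trans)
open import Data.Product using (∃; ∃₂; _×_; _,_)
open import Data.Sum using (_⊎_; inj₁; inj₂)
open import Function using (_∘_)
open import Function.Bundles using (Equivalence)
open import Function.Definitions using (Injective)
open import Relation.Nullary using (¬_; yes; no)
open import Relation.Nullary.Decidable using (toWitness; fromWitness)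
open import Relation.Binary.PropositionalEquality
  using (_≡_; _≢_; refl; sym; trans; cong; subst; module ≡-Reasoning)

open Equivalence using (to; from)

xor≡true⇒ : ∀ b c → b xor c ≡ true → b ≡ false ⊎ c ≡ false
xor≡true⇒ true  false _ = inj₂ refl
xor≡true⇒ false c     _ = inj₁ refl

all≡true⇒∈ : ∀ {A : Set} {p : A → Bool} {xs : List A} {y : A} →
             all p xs ≡ true → y ∈ xs → p y ≡ true
all≡true⇒∈ {xs = xs} eq y∈xs =
  to T-≡ (All.lookup (All.all⁺ _ xs (from T-≡ eq)) y∈xs)

sum-map-≡0 : ∀ {A : Set} (f : A → ℕ) (xs : List A) → (∀ y → f y ≡ 0) → sum (map f xs) ≡ 0
sum-map-≡0 f []       f≡0 = refl
sum-map-≡0 f (y ∷ xs) f≡0 rewrite f≡0 y = sum-map-≡0 f xs f≡0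

γ≡0 : ∀ {n} (G : Graph n) (As : List (Fin n → Bool)) →
      (∀ u v → all (λ A → A u xor A v) As ≢ true) → γ G As ≡ 0
γ≡0 {n} G As nothing-crosses =
  sum-map-≡0 _ (allFin n) λ u → sum-map-≡0 _ (allFin n) λ v →
    if-false (toℕ u <ᵇ toℕ v) (adj G u v) (¬-not (nothing-crosses u v))
  where
    if-false : ∀ b c {d} → d ≡ false → (if b ∧ c ∧ d then 1 else 0) ≡ 0
    if-false b c refl rewrite ∧-zeroʳ c | ∧-zeroʳ b = refl

iter-+ : ∀ {A : Set} (f : A → A) m n a → iter f (m + n) a ≡ iter f m (iter f n a)
iter-+ f 0       n a = refl
iter-+ f (suc m) n a = cong f (iter-+ f m n a)

module Orbit {A : Set} (f : A → A) where

  infix 4 _↝_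
  _↝_ : A → A → Set
  a ↝ b = ∃ λ k → iter f k a ≡ b

  ↝-trans : ∀ {a b c} → a ↝ b → b ↝ c → a ↝ c
  ↝-trans {a} (k , refl) (l , refl) = l + k , iter-+ f l k a

  iter-∸ : ∀ {l k} a → l ≤ k → iter f (k ∸ l) (iter f l a) ≡ iter f k a
  iter-∸ {l} {k} a l≤k = begin
    iter f (k ∸ l) (iter f l a) ≡⟨ sym (iter-+ f (k ∸ l) l a) ⟩
    iter f (k ∸ l + l) a        ≡⟨ cong (λ m → iter f m a) (m∸n+n≡m l≤k) ⟩
    iter f k a                  ∎
    where open ≡-Reasoning

  skip-cycle : ∀ {m l k} a → iter f m a ≡ iter f l a → l ≤ k →
               iter f (k ∸ l + m) a ≡ iter f k a
  skip-cycle {m} {l} {k} a cycle l≤k = begin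
    iter f (k ∸ l + m) a        ≡⟨ iter-+ f (k ∸ l) m a ⟩
    iter f (k ∸ l) (iter f m a) ≡⟨ cong (iter f (k ∸ l)) cycle ⟩
    iter f (k ∸ l) (iter f l a) ≡⟨ iter-∸ a l≤k ⟩
    iter f k a                  ∎
    where open ≡-Reasoning

  ↝-later : ∀ {u b c d e} → iter f d u ≡ b → iter f e u ≡ c → d ≤ e → b ↝ c
  ↝-later {u} {d = d} {e} refl refl d≤e = e ∸ d , iter-∸ u d≤e

  -- The refutable form of "some xs i reaches every xs j", proved by descent on the
  -- distance from u to xs i.
  orbit-family-has-minimum : ∀ {I : Set} (xs : I → A) u → I → (∀ i → u ↝ xs i) →
                             ¬ (∀ i → ∃ λ j → ¬ (xs i ↝ xs j))
  orbit-family-has-minimum xs u i₀ reaches escapes =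
    let d , u→xi₀ = reaches i₀ in <-rec P descend d i₀ u→xi₀
    where
      P : ℕ → Set
      P d = ∀ i → iter f d u ≡ xs i → ⊥

      descend : ∀ d → (∀ {e} → e < d → P e) → P d
      descend d closer i u→xi
        with j , xi↛xj ← escapes i
        with e , u→xj ← reaches j
        with d ≤? e
      ... | yes d≤e = xi↛xj (↝-later u→xi u→xj d≤e)
      ... | no  d≰e = closer (≰⇒> d≰e) j u→xj

module FiniteOrbit {n : ℕ} (f : Fin n → Fin n) where

  open Orbit f

  -- A walk longer than n steps revisits a point (pigeonhole) and the cycle can be cut out.
  ↝-within : ∀ {a b} → a ↝ b → ∃ λ k → k ≤ n × iter f k a ≡ b
  ↝-within {a} {b} (k , a→b) = <-rec P shorten k a→b
    where
      P : ℕ → Set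
      P k = iter f k a ≡ b → ∃ λ k → k ≤ n × iter f k a ≡ b

      shorten : ∀ k → (∀ {k′} → k′ < k → P k′) → P k
      shorten k shorter a→b with k ≤? n
      ... | yes k≤n = k , k≤n , a→b
      ... | no  k≰n
        with i , j , i<j , cycle ← pigeonhole (n<1+n n) (λ i → iter f (toℕ i) a) =
          shorter (subst (k ∸ toℕ j + toℕ i <_) (m∸n+n≡m j≤k) (+-monoʳ-< (k ∸ toℕ j) i<j))
                  (trans (skip-cycle a cycle j≤k) a→b)
        where
          j≤k : toℕ j ≤ k
          j≤k = <⇒≤ (≤-<-trans (s≤s⁻¹ (toℕ<n j)) (≰⇒> k≰n))

module Descendants {n : ℕ} {G : Graph n} (T : RootedSpanningTree G) where

  open Orbit (parent T)
  open FiniteOrbit (parent T)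

  down⇒↝ : ∀ {a b} → down T a b ≡ true → b ↝ a
  down⇒↝ b∈a↓ with find (Any.any⁻ _ (upTo (suc n)) (from T-≡ b∈a↓))
  ... | k , _ , b→a = k , toWitness b→a

  ↝⇒down : ∀ {a b} → b ↝ a → down T a b ≡ true
  ↝⇒down b→a with k , k≤n , b→a′ ← ↝-within b→a =
    to T-≡ (Any.any⁺ _ (lose (∈-upTo⁺ (s≤s k≤n)) (fromWitness b→a′)))

  down-false⇒↛ : ∀ {a b} → down T a b ≡ false → ¬ (b ↝ a)
  down-false⇒↛ b∉a↓ b→a with () ← trans (sym b∉a↓) (↝⇒down b→a)

  down-trans : ∀ {a b c} → down T a b ≡ true → down T b c ≡ true → down T a c ≡ true
  down-trans b∈a↓ c∈b↓ = ↝⇒down (↝-trans (down⇒↝ c∈b↓) (down⇒↝ b∈a↓))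

  module _ {k : ℕ} (x : Fin k → Fin n) (i₀ : Fin k)
           (below-i₀ : ∀ j → down T (x i₀) (x j) ≡ true)
           (escapes : ∀ i → ∃ λ j → up T (x i) (x j) ≡ false) where

    outside-top-crosses-not-all : ∀ u v → down T (x i₀) v ≡ false →
                                  ¬ (∀ i → down T (x i) u xor down T (x i) v ≡ true)
    outside-top-crosses-not-all u v v∉x₀↓ crosses =
      orbit-family-has-minimum x u i₀ (λ i → down⇒↝ (u∈x↓ i))
        (λ i → let j , xj∉xi↑ = escapes i in j , down-false⇒↛ xj∉xi↑)  -- up T a b = down T b a
      where
        v∉x↓ : ∀ i → down T (x i) v ≡ false
        v∉x↓ i = ¬-not λ v∈xi↓ →
          down-false⇒↛ v∉x₀↓ (down⇒↝ (down-trans (below-i₀ i) v∈xi↓))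

        u∈x↓ : ∀ i → down T (x i) u ≡ true
        u∈x↓ i = begin
          down T (x i) u                      ≡⟨ sym (xor-identityʳ _) ⟩
          down T (x i) u xor false            ≡⟨ cong (down T (x i) u xor_) (sym (v∉x↓ i)) ⟩
          down T (x i) u xor down T (x i) v   ≡⟨ crosses i ⟩
          true                                ∎
          where open ≡-Reasoning

    no-edge-crosses-all : ∀ u v → ¬ (∀ i → down T (x i) u xor down T (x i) v ≡ true)
    no-edge-crosses-all u v crosses with xor≡true⇒ _ _ (crosses i₀)
    ... | inj₁ u∉x₀↓ = outside-top-crosses-not-all v u u∉x₀↓
                         (λ i → trans (xor-comm (down T (x i) v) _) (crosses i))
    ... | inj₂ v∉x₀↓ = outside-top-crosses-not-all u v v∉x₀↓ crosses

proposition4p6 : {n : ℕ} (G : Graph n) (T : RootedSpanningTree G)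
    (k : ℕ) (x : Fin k → Fin n) →
    Injective _≡_ _≡_ x →
    k ≥ 3 →
    (∀ i → x i ≢ root T) →
    (∃₂ λ i j → ∃ λ u → down T (x i) u ≡ true × down T (x j) u ≡ true) →
    (∃ λ i → ∀ j → down T (x i) (x j) ≡ true) →
    (∀ i → ∃ λ j → up T (x i) (x j) ≡ false) →
    γ G (map (down T ∘ x) (allFin k)) ≡ 0
proposition4p6 G T k x _ _ _ _ (i₀ , below-i₀) escapes =
  γ≡0 G (map (down T ∘ x) (allFin k)) λ u v crosses-all →
    no-edge-crosses-all x i₀ below-i₀ escapes u v λ i →
      all≡true⇒∈ {p = λ A → A u xor A v} crosses-all (∈-map⁺ (down T ∘ x) (∈-allFin i))
  where open Descendants T
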